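{- Let $W$ be a nonempty finite set of integers. In the additive group $\mathbf{Z}$, every complement to $W$ contains a minimal complement to $W$.
   Context: For subsets $W,C\subseteq\mathbf{Z}$, $W+C=\{w+c:w\in W,c\in C\}$. A set $C\subseteq\mathbf{Z}$ is a complement to $W$ if $W+C=\mathbf{Z}$. A complement $C$ to $W$ is minimal if no proper subset of $C$ is a complement to $W$. -}

module Defs where

open import Level using (0ℓ)
open import Data.Integer using (ℤ; _+_)
open import Data.List using (List)
open import Data.List.Membership.Propositional using (_∈_)
open import Data.Product using (Σ; ∃; _×_)
open import Relation.Binary.PropositionalEquality using (_≡_)
open import Relation.Unary using (Pred; _⊆_)

IsComplement : List ℤ → Pred ℤ 0ℓ → Set
IsComplement W C = ∀ (n : ℤ) → ∃ λ w → ∃ λ c → w ∈ W × C c × n ≡ w + c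

-- C is a minimal complement: a complement such that no proper subset is a
-- complement, i.e. every complement D ⊆ C already contains C (so D = C).
IsMinimalComplement : List ℤ → Pred ℤ 0ℓ → Set₁
IsMinimalComplement W C =
  IsComplement W C × (∀ (D : Pred ℤ 0ℓ) → D ⊆ C → IsComplement W D → C ⊆ D)

-- Constructively we cannot prune C itself, since membership in C need not be
-- decidable.  The hypothesis "W + C = ℤ" however chooses, for every n, a
-- witness c(n) ∈ C; the set of all chosen witnesses is a complement with
-- decidable membership (a Boolean set) contained in C.
--
-- A Boolean complement S is then pruned greedily along an enumeration
-- e₀, e₁, … of ℤ: at step t the element eₜ is deleted iff it is redundant,
-- i.e. each element w + eₜ (w ∈ W) that it covers is also covered by another
-- element of the current set.  Each step preserves the complement property.
-- The limit M (the elements never deleted) is again a complement, because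
-- n = w + c is decided once all candidates c = n - w (finitely many, as W is
-- finite) have been examined; and M is minimal, because each surviving eₜ
-- was irredundant at step t, hence lies in every complement D ⊆ M.
module Submission where

open import Defs
open import Level using (0ℓ)
open import Data.Bool using (Bool; false; T)
open import Data.Integer using (ℤ; +_; -[1+_]; _+_; _-_; _≟_)
import Data.Integer.Properties as ℤP
open import Algebra.Properties.AbelianGroup ℤP.+-0-abelianGroup
  using (xyx⁻¹≈y; //-rightDividesˡ)
open import Data.Nat using (ℕ; zero; suc; _≤_; _<_; _≤′_; ≤′-refl; ≤′-step)
open import Data.Nat.Properties
  using (≤-total; ≤⇒≤′; ≤′⇒≤; <-≤-trans; <⇒≢; m≤m+n; m≤n+m; ≤-trans)
open import Data.Nat.ListAction using (sum)
open import Data.List using (List; []; _∷_; map)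
open import Data.List.Relation.Unary.Any using (Any; here; there; any?)
open import Data.List.Relation.Unary.All using (All; all?)
import Data.List.Relation.Unary.All as All
open import Data.List.Relation.Unary.All.Properties using (¬All⇒Any¬)
open import Data.List.Membership.Propositional using (_∈_; find; lose)
open import Data.Product using (Σ; _×_; _,_; proj₁; proj₂)
open import Data.Sum using (inj₁; inj₂)
open import Data.Empty using (⊥-elim)
open import Relation.Nullary using (Dec; yes; no; ¬_)
open import Relation.Nullary.Decidable using (⌊_⌋; _×-dec_; ¬?; toWitness; fromWitness; T?)
open import Relation.Binary.PropositionalEquality
  using (_≡_; _≢_; refl; sym; trans; cong; subst)
open import Relation.Unary using (Pred; _⊆_)

double : ℕ → ℕ
double zero    = zero
double (suc k) = suc (suc (double k))

index : ℤ → ℕ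
index (+ k)    = double k
index -[1+ k ] = suc (double k)

outward : ℤ → ℤ
outward (+ k)    = + suc k
outward -[1+ k ] = -[1+ suc k ]

enum : ℕ → ℤ
enum zero          = + 0
enum (suc zero)    = -[1+ 0 ]
enum (suc (suc t)) = outward (enum t)

index-enum : ∀ t → index (enum t) ≡ t
index-enum zero          = refl
index-enum (suc zero)    = refl
index-enum (suc (suc t)) = trans (index-outward (enum t)) (cong (λ s → suc (suc s)) (index-enum t))
  where
  index-outward : ∀ x → index (outward x) ≡ suc (suc (index x))
  index-outward (+ k)    = refl
  index-outward -[1+ k ] = refl

enum-index : ∀ x → enum (index x) ≡ x
enum-index (+ k)    = enum-double k
  where
  enum-double : ∀ k → enum (double k) ≡ + k
  enum-double zero    = refl
  enum-double (suc k) = cong outward (enum-double k)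
enum-index -[1+ k ] = enum-suc-double k
  where
  enum-suc-double : ∀ k → enum (suc (double k)) ≡ -[1+ k ]
  enum-suc-double zero    = refl
  enum-suc-double (suc k) = cong outward (enum-suc-double k)

cancel-left : ∀ a b → (a + b) - a ≡ b
cancel-left = xyx⁻¹≈y

add-difference : ∀ a n → a + (n - a) ≡ n
add-difference a n = trans (ℤP.+-comm a (n - a)) (//-rightDividesˡ a n)

≤-sum-map : ∀ {A : Set} (f : A → ℕ) {x xs} → x ∈ xs → f x ≤ sum (map f xs)
≤-sum-map f {xs = x ∷ xs} (here refl) = m≤m+n (f x) (sum (map f xs))
≤-sum-map f {xs = y ∷ xs} (there x∈xs) =
  ≤-trans (≤-sum-map f x∈xs) (m≤n+m (sum (map f xs)) (f y))

⟦_⟧ : (ℤ → Bool) → Pred ℤ 0ℓ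
⟦ S ⟧ c = T (S c)

module Pruning (W : List ℤ) where

  CoveredElsewhere : (ℤ → Bool) → ℤ → ℤ → ℤ → Set
  CoveredElsewhere S y w w' = ((w + y) - w') ≢ y × T (S ((w + y) - w'))

  Redundant : (ℤ → Bool) → ℤ → Set
  Redundant S y = All (λ w → Any (CoveredElsewhere S y w) W) W

  covered-elsewhere? : ∀ S y w w' → Dec (CoveredElsewhere S y w w')
  covered-elsewhere? S y w w' = ¬? (((w + y) - w') ≟ y) ×-dec T? (S ((w + y) - w'))

  redundant? : ∀ S y → Dec (Redundant S y)
  redundant? S y = all? (λ w → any? (covered-elsewhere? S y w) W) W

  prune : (ℤ → Bool) → ℤ → ℤ → Bool
  prune S y x with x ≟ y | redundant? S y
  ... | yes _ | yes _ = false
  ... | _     | _     = S x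

  prune-⊆ : ∀ {S y} → ⟦ prune S y ⟧ ⊆ ⟦ S ⟧
  prune-⊆ {S} {y} {x} x∈ with x ≟ y | redundant? S y
  ... | yes _ | yes _ = ⊥-elim x∈
  ... | yes _ | no _  = x∈
  ... | no _  | _     = x∈

  prune-keeps-other : ∀ {S y x} → x ≢ y → T (S x) → T (prune S y x)
  prune-keeps-other {S} {y} {x} x≢y x∈ with x ≟ y | redundant? S y
  ... | yes x≡y | _ = ⊥-elim (x≢y x≡y)
  ... | no _    | _ = x∈

  prune-keeps-irredundant : ∀ {S y x} → ¬ Redundant S y → T (S x) → T (prune S y x)
  prune-keeps-irredundant {S} {y} {x} irr x∈ with x ≟ y | redundant? S y
  ... | _     | yes red = ⊥-elim (irr red)
  ... | yes _ | no _    = x∈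
  ... | no _  | no _    = x∈

  survivor-irredundant : ∀ {S y} → T (prune S y y) → ¬ Redundant S y
  survivor-irredundant {S} {y} y∈ with y ≟ y | redundant? S y
  ... | yes _   | yes _ = ⊥-elim y∈
  ... | yes _   | no irr = irr
  ... | no y≢y  | _      = ⊥-elim (y≢y refl)

  prune-complement : ∀ {S y} → IsComplement W ⟦ S ⟧ → IsComplement W ⟦ prune S y ⟧
  prune-complement {S} {y} cov n with cov n
  ... | w , c , w∈W , c∈S , n≡w+c with c ≟ y
  ...   | no c≢y   = w , c , w∈W , prune-keeps-other c≢y c∈S , n≡w+c
  ...   | yes refl = cover-via-y (redundant? S y)
    where
    -- n = w + y; if y is redundant, reroute n through another element.
    cover-via-y : Dec (Redundant S y) →
      Σ ℤ λ w → Σ ℤ λ c → w ∈ W × T (prune S y c) × n ≡ w + c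
    cover-via-y (no irr)  = w , y , w∈W , prune-keeps-irredundant {S} irr c∈S , n≡w+c
    cover-via-y (yes red) with find (All.lookup red w∈W)
    ... | w' , w'∈W , c'≢y , c'∈S =
      w' , (w + y) - w' , w'∈W , prune-keeps-other c'≢y c'∈S ,
      trans n≡w+c (sym (add-difference w' (w + y)))

  irredundant-essential : ∀ {S y} → ¬ Redundant S y →
    (D : Pred ℤ 0ℓ) → D ⊆ ⟦ S ⟧ → IsComplement W D → D y
  irredundant-essential {S} {y} irr D D⊆S covD
    with find (¬All⇒Any¬ (λ w → any? (covered-elsewhere? S y w) W) W irr)
  ... | w , w∈W , not-elsewhere with covD (w + y)
  ...   | w' , d , w'∈W , d∈D , w+y≡w'+d with d ≟ y
  ...     | yes d≡y = subst D d≡y d∈D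
  ...     | no d≢y  = ⊥-elim (not-elsewhere (lose w'∈W (d'≢y , D⊆S d'∈D)))
    where
    d-as-difference : (w + y) - w' ≡ d
    d-as-difference = trans (cong (_- w') w+y≡w'+d) (cancel-left w' d)
    d'≢y : (w + y) - w' ≢ y
    d'≢y eq = d≢y (trans (sym d-as-difference) eq)
    d'∈D : D ((w + y) - w')
    d'∈D = subst D (sym d-as-difference) d∈D

  module Limit (S₀ : ℤ → Bool) where

    -- stage t is S₀ after the elements enum 0, …, enum (t-1) have been examined.
    stage : ℕ → ℤ → Bool
    stage zero    = S₀
    stage (suc t) = prune (stage t) (enum t)

    M : Pred ℤ 0ℓ
    M x = ∀ t → T (stage t x)

    stage-antitone : ∀ {s t x} → s ≤′ t → T (stage t x) → T (stage s x)
    stage-antitone ≤′-refl      x∈ = x∈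
    stage-antitone (≤′-step {t} s≤t) x∈ = stage-antitone s≤t (prune-⊆ {stage t} x∈)

    stage-persists : ∀ {u t x} → index x < u → u ≤′ t → T (stage u x) → T (stage t x)
    stage-persists lt ≤′-refl       x∈ = x∈
    stage-persists {x = x} lt (≤′-step {t} u≤t) x∈ =
      prune-keeps-other x≢enum (stage-persists lt u≤t x∈)
      where
      x≢enum : x ≢ enum t
      x≢enum x≡e = <⇒≢ (<-≤-trans lt (≤′⇒≤ u≤t)) (trans (cong index x≡e) (index-enum t))

    settled : ∀ {u x} → index x < u → T (stage u x) → M x
    settled {u} lt x∈ t with ≤-total t u
    ... | inj₁ t≤u = stage-antitone (≤⇒≤′ t≤u) x∈
    ... | inj₂ u≤t = stage-persists lt (≤⇒≤′ u≤t) x∈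

    M⊆S₀ : M ⊆ ⟦ S₀ ⟧
    M⊆S₀ x∈M = x∈M zero

    stage-complement : IsComplement W ⟦ S₀ ⟧ → ∀ t → IsComplement W ⟦ stage t ⟧
    stage-complement cov zero    = cov
    stage-complement cov (suc t) = prune-complement (stage-complement cov t)

    -- By this stage every candidate n - w (w ∈ W) for covering n is settled.
    bound : ℤ → ℕ
    bound n = sum (map (λ w → suc (index (n - w))) W)

    -- n is covered at stage (bound n) by some c = n - w, which is settled there.
    M-complement : IsComplement W ⟦ S₀ ⟧ → IsComplement W M
    M-complement cov n with stage-complement cov (bound n) n
    ... | w , c , w∈W , c∈S , n≡w+c = w , c , w∈W , settled index<bound c∈S , n≡w+c
      where
      c≡n-w : c ≡ n - w
      c≡n-w = trans (sym (cancel-left w c)) (cong (_- w) (sym n≡w+c))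
      index<bound : index c < bound n
      index<bound = subst (λ z → suc (index z) ≤ bound n) (sym c≡n-w)
                          (≤-sum-map (λ w → suc (index (n - w))) w∈W)

    -- Each m ∈ M survived its own step, so it is essential in every D ⊆ M.
    M-minimal : ∀ (D : Pred ℤ 0ℓ) → D ⊆ M → IsComplement W D → M ⊆ D
    M-minimal D D⊆M covD {m} m∈M = subst D (enum-index m)
      (irredundant-essential (survivor-irredundant survives) D (λ d∈D → D⊆M d∈D t) covD)
      where
      t : ℕ
      t = index m
      survives : T (stage (suc t) (enum t))
      survives = subst (λ x → T (stage (suc t) x)) (sym (enum-index m)) (m∈M (suc t))

  minimal-in-boolean : ∀ S → IsComplement W ⟦ S ⟧ →
    Σ (Pred ℤ 0ℓ) (λ M → M ⊆ ⟦ S ⟧ × IsMinimalComplement W M)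
  minimal-in-boolean S cov = M , M⊆S₀ , M-complement cov , M-minimal
    where open Limit S

-- Every complement contains a Boolean complement: keep, for each n, only the
-- witness c(n) that the hypothesis chose for n.
boolean-subcomplement : ∀ W (C : Pred ℤ 0ℓ) → IsComplement W C →
  Σ (ℤ → Bool) (λ S → ⟦ S ⟧ ⊆ C × IsComplement W ⟦ S ⟧)
boolean-subcomplement W C covC = S , S⊆C , covS
  where
  chosen : ℤ → ℤ
  chosen n = proj₁ (proj₂ (covC n))

  chosen-for? : ∀ c → Dec (Any (λ w → chosen (w + c) ≡ c) W)
  chosen-for? c = any? (λ w → chosen (w + c) ≟ c) W

  S : ℤ → Bool
  S c = ⌊ chosen-for? c ⌋

  S⊆C : ⟦ S ⟧ ⊆ C
  S⊆C {c} c∈S with find (toWitness {a? = chosen-for? c} c∈S)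
  ... | w , _ , chosen≡c = subst C chosen≡c (proj₁ (proj₂ (proj₂ (proj₂ (covC (w + c))))))

  covS : IsComplement W ⟦ S ⟧
  covS n = w , chosen n , w∈W ,
            fromWitness {a? = chosen-for? (chosen n)} (lose w∈W (cong chosen (sym n≡w+c))) ,
            n≡w+c
    where
    w : ℤ
    w = proj₁ (covC n)
    w∈W : w ∈ W
    w∈W = proj₁ (proj₂ (proj₂ (covC n)))
    n≡w+c : n ≡ w + chosen n
    n≡w+c = proj₂ (proj₂ (proj₂ (proj₂ (covC n))))

-- The theorem.
mainTheorem9 : (W : List ℤ) → W ≢ [] → (C : Pred ℤ 0ℓ) → IsComplement W C →
    Σ (Pred ℤ 0ℓ) (λ M → M ⊆ C × IsMinimalComplement W M)
mainTheorem9 W _ C covC with boolean-subcomplement W C covC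
... | S , S⊆C , covS with Pruning.minimal-in-boolean W S covS
...   | M , M⊆S , minimal = M , (λ m∈M → S⊆C (M⊆S m∈M)) , minimal
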